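{- Let $G$ be a graph and $k\ge1$ an integer. If $G$ has a tight bramble of order $k$, then $\mathsf{avms}(G)\ge k$.
   Context: Graphs are finite and simple; $\ominus$ is symmetric difference. Two sets $S_1,S_2\subseteq V(G)$ are touching if $S_1\cap S_2\ne\emptyset$ or there are two distinct edges $x_1x_2,y_1y_2\in E(G)$ with $x_1,y_1\in S_1$, $x_2,y_2\in S_2$. A tight bramble of $G$ is a set $\mathcal B$ of pairwise touching subsets of $V(G)$, each inducing a connected subgraph and of size at least two; a cover is a set of vertices meeting every element, and the order is the minimum size of a cover. Mixed search game against an agile visible fugitive. A pair $(S,S')$ of subsets of $V(G)$ is a legitimate move if $|S\ominus S'|\in\{1,2\}$ and, when $|S\ominus S'|=2$, $S\ominus S'$ is an edge of $G$. Define $\mathsf{clear}(S,S')=\{xy\in E(G): x\in S\}$ if $S'\setminus S=\{y\}$, and $\emptyset$ if $S'\setminus S=\emptyset$. A pathway is a sequence of edges in which consecutive edges are distinct and share a vertex. A pathway $\langle f_1,\dots,f_t\rangle$, $t\ge2$, is $(S,S')$-avoiding if (i) for each $j\in[2,t]$ the common vertex of $f_{j-1},f_j$ is not in $S\cap S'$, and (ii) if $S'\setminus\{y\}=S\setminus\{x\}$ for an edge $xy$ (a slide from $x$ to $y$) and $xy$ occurs in the pathway, then $xy=f_1$ or $xy=f_t$, and if $xy=f_1=f_t$ then $t>2$. Let $A(S,e,S')$ be the set of edges $e'$ not having both endpoints in $S'$ for which there is an $(S,S')$-avoiding pathway from $e$ to $e'$, and $\mathsf{fsp}(S,e,S')=(\{e\}\setminus\mathsf{clear}(S,S'))\cup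 A(S,e,S')$. A search strategy is a function $\mathbf s$ mapping each $(S,e)$, $S\subseteq V(G)$, $e\in E(G)$, to a set $\mathbf s(S,e)$ with $(S,\mathbf s(S,e))$ legitimate. A fugitive strategy is a pair $(e_1,\mathbf f)$, $e_1\in E(G)$, with $\mathbf f(S,e,S')\in\mathsf{fsp}(S,e,S')$ if this set is nonempty and $\mathbf f(S,e,S')=\star$ otherwise. The generated play is $\langle S_0,e_1,S_1,e_2,\dots\rangle$ with $S_0=\emptyset$, $S_i=\mathbf s(S_{i-1},e_i)$, $e_{i+1}=\mathbf f(S_{i-1},e_i,S_i)$, finite iff $\star$ appears. The cost of $\mathbf s$ is the maximum $|S_i|$ over all plays against all fugitive strategies; $\mathbf s$ is winning if all its plays are finite. $\mathsf{avms}(G)$ is the minimum cost of a winning search strategy. -}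

module Defs where

open import Data.Nat using (ℕ; zero; suc; _≤_; _<_)
open import Data.Fin using (Fin) renaming (_<_ to _<ᶠ_)
open import Data.Fin.Subset using (Subset; _∈_; _∉_; ∣_∣; ⊥)
open import Data.Bool using (Bool; true; false)
open import Data.Maybe using (Maybe; just; nothing)
open import Data.List using (List; []; _∷_; _++_; [_])
open import Data.List.Relation.Unary.Linked using (Linked)
import Data.List.Membership.Propositional as LM
open import Data.Product using (Σ; ∃; ∃-syntax; _×_; _,_; proj₁; proj₂)
open import Data.Sum using (_⊎_)
open import Relation.Binary.PropositionalEquality using (_≡_; _≢_)
open import Relation.Nullary using (¬_)

record Graph : Set where
  field
    n      : ℕ
    adj    : Fin n → Fin n → Bool
    sym    : ∀ x y → adj x y ≡ adj y x
    irrefl : ∀ x → adj x x ≡ false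

module _ (G : Graph) where
  open Graph G

  Vertex : Set
  Vertex = Fin n

  VSet : Set
  VSet = Subset n

  Adj : Vertex → Vertex → Set
  Adj x y = adj x y ≡ true

  -- An edge, stored canonically with its smaller endpoint first.
  record Edge : Set where
    constructor mkEdge
    field
      lo    : Vertex
      hi    : Vertex
      lo<hi : lo <ᶠ hi
      isAdj : Adj lo hi
  open Edge public

  Ends : Edge → Vertex → Vertex → Set
  Ends e x y = (lo e ≡ x × hi e ≡ y) ⊎ (lo e ≡ y × hi e ≡ x)

  _∈ₑ_ : Vertex → Edge → Set
  v ∈ₑ e = v ≡ lo e ⊎ v ≡ hi e

  data ReachIn (X : VSet) : Vertex → Vertex → Set where
    here  : ∀ {u} → u ∈ X → ReachIn X u u
    there : ∀ {u w v} → u ∈ X → Adj u w → ReachIn X w v → ReachIn X u v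

  Connected : VSet → Set
  Connected X = ∀ u v → u ∈ X → v ∈ X → ReachIn X u v

  Touching : VSet → VSet → Set
  Touching X Y =
    (∃[ v ] (v ∈ X × v ∈ Y)) ⊎
    (∃[ e₁ ] ∃[ e₂ ] (e₁ ≢ e₂ × ∃[ x₁ ] ∃[ x₂ ] ∃[ y₁ ] ∃[ y₂ ]
       (Ends e₁ x₁ x₂ × Ends e₂ y₁ y₂ × x₁ ∈ X × y₁ ∈ X × x₂ ∈ Y × y₂ ∈ Y)))

  -- a bramble is a (finite) set of vertex sets, given as a list
  TightBramble : List VSet → Set
  TightBramble B =
    (∀ X → X LM.∈ B → Connected X × 2 ≤ ∣ X ∣) ×
    (∀ X Y → X LM.∈ B → Y LM.∈ B → Touching X Y)

  IsCover : List VSet → VSet → Set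
  IsCover B C = ∀ X → X LM.∈ B → ∃[ v ] (v ∈ C × v ∈ X)

  HasOrder : List VSet → ℕ → Set
  HasOrder B k =
    (∃[ C ] (IsCover B C × ∣ C ∣ ≡ k)) × (∀ C → IsCover B C → k ≤ ∣ C ∣)

  InSymDiff : VSet → VSet → Vertex → Set
  InSymDiff S S' v = (v ∈ S × v ∉ S') ⊎ (v ∉ S × v ∈ S')

  Legit : VSet → VSet → Set
  Legit S S' =
    (∃[ y ] (∀ w → (InSymDiff S S' w → w ≡ y) × (w ≡ y → InSymDiff S S' w))) ⊎
    (∃[ e ] (∀ w → (InSymDiff S S' w → w ∈ₑ e) × (w ∈ₑ e → InSymDiff S S' w)))

  AddsOnly : VSet → VSet → Vertex → Set
  AddsOnly S S' y = ∀ w → ((w ∈ S' × w ∉ S) → w ≡ y) × (w ≡ y → (w ∈ S' × w ∉ S))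

  InClear : VSet → VSet → Edge → Set
  InClear S S' f = ∃[ y ] (AddsOnly S S' y × ∃[ x ] (x ∈ S × Ends f x y))

  Slide : VSet → VSet → Vertex → Vertex → Set
  Slide S S' x y =
    Adj x y × x ∈ S × y ∈ S' ×
    (∀ w → ((w ∈ S' × w ≢ y) → (w ∈ S × w ≢ x)) × ((w ∈ S × w ≢ x) → (w ∈ S' × w ≢ y)))

  Step : VSet → VSet → Edge → Edge → Set
  Step S S' f g = f ≢ g × ∃[ v ] (v ∈ₑ f × v ∈ₑ g × ¬ (v ∈ S × v ∈ S'))

  -- An (S,S')-avoiding pathway ⟨ f₁ = e , mid ... , f_t = e' ⟩ (t = length mid + 2 ≥ 2).
  Avoiding : VSet → VSet → Edge → List Edge → Edge → Set
  Avoiding S S' e mid e' =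
    Linked (Step S S') (e ∷ mid ++ [ e' ]) ×
    (∀ x y → Slide S S' x y → ∀ h → Ends h x y → h LM.∈ (e ∷ mid ++ [ e' ]) →
       (h ≡ e ⊎ h ≡ e') × ((h ≡ e × h ≡ e') → ∃[ g ] (g LM.∈ mid)))

  InA : VSet → Edge → VSet → Edge → Set
  InA S e S' e' = ¬ (lo e' ∈ S' × hi e' ∈ S') × ∃[ mid ] Avoiding S S' e mid e'

  InFsp : VSet → Edge → VSet → Edge → Set
  InFsp S e S' e' = (e' ≡ e × ¬ InClear S S' e) ⊎ InA S e S' e'

  SearchStrategy : Set
  SearchStrategy = Σ (VSet → Edge → VSet) λ s → ∀ S e → Legit S (s S e)

  -- the value nothing plays the role of ⋆
  ValidFugitiveFn : (VSet → Edge → VSet → Maybe Edge) → Set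
  ValidFugitiveFn f = ∀ S e S' → FspOK S e S' (f S e S')
    where
      FspOK : VSet → Edge → VSet → Maybe Edge → Set
      FspOK S e S' (just e') = InFsp S e S' e'
      FspOK S e S' nothing   = ∀ e' → ¬ InFsp S e S' e'

  FugitiveStrategy : Set
  FugitiveStrategy = Edge × Σ (VSet → Edge → VSet → Maybe Edge) ValidFugitiveFn

  -- play s (e₁ , f) i = (S_i , e_{i+1}); after ⋆ the state is frozen
  play : SearchStrategy → FugitiveStrategy → ℕ → VSet × Maybe Edge
  play s (e₁ , f , ok) zero = ⊥ , just e₁
  play s (e₁ , f , ok) (suc i) = next (play s (e₁ , f , ok) i)
    where
      next : VSet × Maybe Edge → VSet × Maybe Edge
      next (S , nothing) = S , nothing
      next (S , just e)  = proj₁ s S e , f S e (proj₁ s S e)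

  Winning : SearchStrategy → Set
  Winning s = ∀ φ → ∃[ i ] (proj₂ (play s φ i) ≡ nothing)

  CostAtLeast : SearchStrategy → ℕ → Set
  CostAtLeast s k = ∃[ φ ] ∃[ i ] (k ≤ ∣ proj₁ (play s φ i) ∣)

  AvmsAtLeast : ℕ → Set
  AvmsAtLeast k = ∀ s → Winning s → CostAtLeast s k

{-# OPTIONS --safe #-}

-- The fugitive always stands on an edge inside a bramble element containing no
-- searcher. When the searchers move from S to S′ with |S′| < k, S′ is not a cover,
-- so some bramble element Y avoids S′, while the current element X avoids S. Since X
-- and Y touch, walking inside X, through a common vertex or a connecting edge, and
-- into Y is an (S,S′)-avoiding pathway: no vertex of X or Y lies in S ∩ S′, and the
-- slide edge (tail in S, head in S′) lies inside neither X nor Y; of two distinct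
-- connecting edges at most one is the slide edge. So every play lasts until some
-- position has at least k searchers, and a winning strategy ends every play.

module Submission where

open import Defs
open import Axiom.UniquenessOfIdentityProofs using (module Decidable⇒UIP)
open import Data.Bool using (true)
import Data.Bool.Properties as Bool
open import Data.Empty using (⊥-elim)
open import Data.Fin using (_<_)
open import Data.Fin.Properties using (_≟_; <-cmp; _<?_; <-asym; <-irrelevant; any?; all?)
open import Data.Fin.Subset using (Subset; _∈_; _∉_; ∣_∣; ⊥; ⁅_⁆; _⊆_; Nonempty)
open import Data.Fin.Subset.Properties
  using (_∈?_; ∉⊥; ∣⊥∣≡0; x∈⁅x⁆; ∣⁅x⁆∣≡1; p⊆q⇒∣p∣≤∣q∣; nonempty?; Empty-unique)
open import Data.List using (List; []; _∷_; _++_; [_]; mapMaybe; cartesianProduct; allFin)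
open import Data.List.Membership.Propositional using (find; lose) renaming (_∈_ to _∈ˡ_)
open import Data.List.Membership.Propositional.Properties using (∈-cartesianProduct⁺; ∈-allFin)
open import Data.List.Relation.Unary.All as All using (All; []; _∷_)
open import Data.List.Relation.Unary.Any as Any using (here; there)
open import Data.List.Relation.Unary.Any.Properties using (mapMaybe⁺; map⁺)
open import Data.List.Relation.Unary.Linked as Linked using (Linked; [-]; _∷_)
open import Data.Maybe using (Maybe; just; nothing)
import Data.Maybe.Relation.Unary.Any as MaybeAny
open import Data.Nat using (ℕ; zero; suc; _≤_; s≤s; z≤n)
open import Data.Nat.Properties using (≤-trans)
open import Data.Product using (∃; ∃₂; _×_; _,_; proj₁; proj₂)
open import Data.Sum using (_⊎_; inj₁; inj₂)
open import Level using (0ℓ)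
open import Relation.Binary using (Rel; DecidableEquality; tri<; tri≈; tri>)
import Relation.Binary as B
open import Relation.Binary.Construct.Closure.ReflexiveTransitive using (Star; ε; _◅_; _◅◅_)
open import Relation.Binary.Construct.Closure.Transitive using (TransClosure; _∷_)
  renaming ([_] to [_]⁺; _++_ to _++⁺_)
open import Relation.Binary.PropositionalEquality using (_≡_; _≢_; refl; sym; trans; cong; cong₂; subst; subst₂)
open import Relation.Nullary using (¬_; Dec; yes; no; contradiction)
open import Relation.Nullary.Decidable using (_×-dec_; _⊎-dec_; _→-dec_; ¬?; map′)
open import Relation.Unary using (Pred; Decidable)

module _ {A : Set} where

  ∃∈? : {P : Pred A 0ℓ} → Decidable P → (xs : List A) → Dec (∃ λ x → x ∈ˡ xs × P x)
  ∃∈? P? xs = map′ find (λ (_ , x∈xs , px) → lose x∈xs px) (Any.any? P? xs)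

module _ {A : Set} {R : Rel A 0ℓ} where

  ◅⇒⁺ : ∀ {x y z} → R x y → Star R y z → TransClosure R x z
  ◅⇒⁺ r ε        = [ r ]⁺
  ◅⇒⁺ r (r′ ◅ rs) = r ∷ ◅⇒⁺ r′ rs

  ⁺⇒Linked : ∀ {x y} → TransClosure R x y → ∃ λ mid → Linked R (x ∷ mid ++ [ y ])
  ⁺⇒Linked [ r ]⁺           = [] , r ∷ [-]
  ⁺⇒Linked (_∷_ {y = c} r p) = let mid , l = ⁺⇒Linked p in c ∷ mid , r ∷ l

  Linked⇒⁺ : ∀ {x y} mid → Linked R (x ∷ mid ++ [ y ]) → TransClosure R x y
  Linked⇒⁺ []        (r ∷ [-]) = [ r ]⁺
  Linked⇒⁺ (c ∷ mid) (r ∷ l)   = r ∷ Linked⇒⁺ mid l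

  module _ {Q : Pred A 0ℓ} where

    Linked-targets : ∀ {x xs} → Linked (λ a b → R a b × Q b) (x ∷ xs) → All Q xs
    Linked-targets [-]          = []
    Linked-targets ((_ , q) ∷ l) = q ∷ Linked-targets l

    Linked-restrict : ∀ {x xs} → Linked R (x ∷ xs) → All Q xs → Linked (λ a b → R a b × Q b) (x ∷ xs)
    Linked-restrict [-]     []       = [-]
    Linked-restrict (r ∷ l) (q ∷ qs) = (r , q) ∷ Linked-restrict l qs

-- Floyd–Warshall: Via cs a b holds when there is an R-path from a to b all of whose
-- intermediate vertices lie in cs.
module FloydWarshall {A : Set} (R : Rel A 0ℓ) where

  Via : List A → A → A → Set
  Via []       a b = R a b
  Via (c ∷ cs) a b = Via cs a b ⊎ (Via cs a c × Via cs c b)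

  via? : B.Decidable R → ∀ cs → B.Decidable (Via cs)
  via? R? []       a b = R? a b
  via? R? (c ∷ cs) a b = via? R? cs a b ⊎-dec (via? R? cs a c ×-dec via? R? cs c b)

  via⇒⁺ : ∀ cs {a b} → Via cs a b → TransClosure R a b
  via⇒⁺ []       r              = [ r ]⁺
  via⇒⁺ (c ∷ cs) (inj₁ p)       = via⇒⁺ cs p
  via⇒⁺ (c ∷ cs) (inj₂ (p , q)) = via⇒⁺ cs p ++⁺ via⇒⁺ cs q

  R⇒via : ∀ cs {a b} → R a b → Via cs a b
  R⇒via []       r = r
  R⇒via (c ∷ cs) r = inj₁ (R⇒via cs r)

  via-trans : ∀ cs {a b c} → c ∈ˡ cs → Via cs a c → Via cs c b → Via cs a b
  via-trans (d ∷ cs) (here refl) p q = inj₂ (into p , out q)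
    where
      into : ∀ {a} → Via (d ∷ cs) a d → Via cs a d
      into (inj₁ p)       = p
      into (inj₂ (p , _)) = p
      out : ∀ {b} → Via (d ∷ cs) d b → Via cs d b
      out (inj₁ q)       = q
      out (inj₂ (_ , q)) = q
  via-trans (d ∷ cs) (there c∈cs) (inj₁ p)         (inj₁ q)         = inj₁ (via-trans cs c∈cs p q)
  via-trans (d ∷ cs) (there c∈cs) (inj₁ p)         (inj₂ (q₁ , q₂)) = inj₂ (via-trans cs c∈cs p q₁ , q₂)
  via-trans (d ∷ cs) (there c∈cs) (inj₂ (p₁ , p₂)) (inj₁ q)         = inj₂ (p₁ , via-trans cs c∈cs p₂ q)
  via-trans (d ∷ cs) (there c∈cs) (inj₂ (p₁ , _))  (inj₂ (_ , q₂))  = inj₂ (p₁ , q₂)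

  ⁺⇒via : ∀ cs → (∀ x → x ∈ˡ cs) → ∀ {a b} → TransClosure R a b → Via cs a b
  ⁺⇒via cs complete [ r ]⁺            = R⇒via cs r
  ⁺⇒via cs complete (_∷_ {y = c} r p) =
    via-trans cs (complete c) (R⇒via cs r) (⁺⇒via cs complete p)

  ⁺? : B.Decidable R → ∀ cs → (∀ x → x ∈ˡ cs) → B.Decidable (TransClosure R)
  ⁺? R? cs complete a b = map′ (via⇒⁺ cs) (⁺⇒via cs complete) (via? R? cs a b)

Disjoint : ∀ {n} → Subset n → Subset n → Set
Disjoint Z T = ∀ v → v ∈ Z → v ∉ T

Disjoint? : ∀ {n} (Z T : Subset n) → Dec (Disjoint Z T)
Disjoint? Z T = all? λ v → (v ∈? Z) →-dec ¬? (v ∈? T)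

Disjoint-⊥ : ∀ {n} (Z : Subset n) → Disjoint Z ⊥
Disjoint-⊥ Z v _ = ∉⊥

module Edges (G : Graph) where
  open Graph G using (n; adj) renaming (sym to adj-sym; irrefl to adj-irrefl)

  infix 4 _∈ᵉ_
  _∈ᵉ_ : Vertex G → Edge G → Set
  v ∈ᵉ e = _∈ₑ_ G v e

  Adj? : B.Decidable (Adj G)
  Adj? x y = adj x y Bool.≟ true

  Adj⇒≢ : ∀ {x y} → Adj G x y → x ≢ y
  Adj⇒≢ {x} xy refl with trans (sym xy) (adj-irrefl x)
  ... | ()

  edge-≡ : ∀ {e f : Edge G} → lo e ≡ lo f → hi e ≡ hi f → e ≡ f
  edge-≡ {mkEdge l h l<h a} {mkEdge .l .h l<h′ a′} refl refl =
    cong₂ (mkEdge l h) (<-irrelevant l<h l<h′) (Decidable⇒UIP.≡-irrelevant Bool._≟_ a a′)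

  _≟ᵉ_ : DecidableEquality (Edge G)
  e ≟ᵉ f with lo e ≟ lo f | hi e ≟ hi f
  ... | yes p  | yes q  = yes (edge-≡ p q)
  ... | no ¬p  | _      = no λ e≡f → ¬p (cong lo e≡f)
  ... | yes _  | no ¬q  = no λ e≡f → ¬q (cong hi e≡f)

  toEdge : ∀ {x y} → Adj G x y → ∃ λ e → Ends G e x y
  toEdge {x} {y} xy with <-cmp x y
  ... | tri< x<y _ _ = mkEdge x y x<y xy , inj₁ (refl , refl)
  ... | tri≈ _ x≡y _ = ⊥-elim (Adj⇒≢ xy x≡y)
  ... | tri> _ _ y<x = mkEdge y x y<x (trans (adj-sym y x) xy) , inj₂ (refl , refl)

  edgeAt : Vertex G × Vertex G → Maybe (Edge G)
  edgeAt (x , y) with x <? y | Adj? x y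
  ... | yes x<y | yes xy = just (mkEdge x y x<y xy)
  ... | _       | _      = nothing

  edgeAt-lo-hi : ∀ e → edgeAt (lo e , hi e) ≡ just e
  edgeAt-lo-hi (mkEdge l h l<h a) with l <? h | Adj? l h
  ... | yes _    | yes _  = cong just (edge-≡ refl refl)
  ... | no l≮h   | _      = contradiction l<h l≮h
  ... | yes _    | no ¬a  = contradiction a ¬a

  edges : List (Edge G)
  edges = mapMaybe edgeAt (cartesianProduct (allFin n) (allFin n))

  ∈-edges : ∀ e → e ∈ˡ edges
  ∈-edges e = mapMaybe⁺ edgeAt _ (map⁺ (lose lo,hi∈pairs e∈edgeAt))
    where
      lo,hi∈pairs : (lo e , hi e) ∈ˡ cartesianProduct (allFin n) (allFin n)
      lo,hi∈pairs = ∈-cartesianProduct⁺ (∈-allFin (lo e)) (∈-allFin (hi e))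
      e∈edgeAt : MaybeAny.Any (e ≡_) (edgeAt (lo e , hi e))
      e∈edgeAt = subst (MaybeAny.Any (e ≡_)) (sym (edgeAt-lo-hi e)) (MaybeAny.just refl)

  ∃ᵉ? : {P : Pred (Edge G) 0ℓ} → Decidable P → Dec (∃ P)
  ∃ᵉ? P? = map′ (λ (e , _ , pe) → e , pe) (λ (e , pe) → e , ∈-edges e , pe) (∃∈? P? edges)

  Ends? : ∀ e x y → Dec (Ends G e x y)
  Ends? e x y = ((lo e ≟ x) ×-dec (hi e ≟ y)) ⊎-dec ((lo e ≟ y) ×-dec (hi e ≟ x))

  _∈ᵉ?_ : ∀ v e → Dec (v ∈ᵉ e)
  v ∈ᵉ? e = (v ≟ lo e) ⊎-dec (v ≟ hi e)

  Ends⇒∈ᵉˡ : ∀ e {x y} → Ends G e x y → x ∈ᵉ e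
  Ends⇒∈ᵉˡ _ (inj₁ (refl , _)) = inj₁ refl
  Ends⇒∈ᵉˡ _ (inj₂ (_ , refl)) = inj₂ refl

  Ends⇒∈ᵉʳ : ∀ e {x y} → Ends G e x y → y ∈ᵉ e
  Ends⇒∈ᵉʳ _ (inj₁ (_ , refl)) = inj₂ refl
  Ends⇒∈ᵉʳ _ (inj₂ (refl , _)) = inj₁ refl

  Ends⇒⊆ : ∀ {Z : VSet G} e {x y} → Ends G e x y → x ∈ Z → y ∈ Z → lo e ∈ Z × hi e ∈ Z
  Ends⇒⊆ _ (inj₁ (refl , refl)) x∈Z y∈Z = x∈Z , y∈Z
  Ends⇒⊆ _ (inj₂ (refl , refl)) x∈Z y∈Z = y∈Z , x∈Z

  Ends-injective : ∀ e f {x y} → Ends G e x y → Ends G f x y → e ≡ f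
  Ends-injective _ _ (inj₁ (p , q)) (inj₁ (p′ , q′)) = edge-≡ (trans p (sym p′)) (trans q (sym q′))
  Ends-injective _ _ (inj₂ (p , q)) (inj₂ (p′ , q′)) = edge-≡ (trans p (sym p′)) (trans q (sym q′))
  Ends-injective e f (inj₁ (refl , refl)) (inj₂ (p , q)) =
    ⊥-elim (<-asym (lo<hi e) (subst₂ _<_ p q (lo<hi f)))
  Ends-injective e f (inj₂ (refl , refl)) (inj₁ (p , q)) =
    ⊥-elim (<-asym (lo<hi e) (subst₂ _<_ p q (lo<hi f)))

  ReachIn-source : ∀ {Z u v} → ReachIn G Z u v → u ∈ Z
  ReachIn-source (here u∈Z)      = u∈Z
  ReachIn-source (there u∈Z _ _) = u∈Z

  1≤∣X∣⇒Nonempty : ∀ (X : VSet G) → 1 ≤ ∣ X ∣ → Nonempty X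
  1≤∣X∣⇒Nonempty X 1≤∣X∣ with nonempty? X
  ... | yes v∈X = v∈X
  ... | no empty = contradiction (subst (1 ≤_) ∣X∣≡0 1≤∣X∣) λ ()
    where
      ∣X∣≡0 : ∣ X ∣ ≡ 0
      ∣X∣≡0 = trans (cong ∣_∣ (Empty-unique empty)) (∣⊥∣≡0 n)

  neighbour : ∀ {Y : VSet G} → Connected G Y → 2 ≤ ∣ Y ∣ → ∀ {v} → v ∈ Y →
              ∃ λ w → w ∈ Y × Adj G v w
  neighbour {Y} Y-conn 2≤∣Y∣ {v} v∈Y with any? (λ u → (u ∈? Y) ×-dec ¬? (u ≟ v))
  ... | yes (u , u∈Y , u≢v) with Y-conn v u v∈Y u∈Y
  ...   | here _        = contradiction refl u≢v
  ...   | there _ vw wu = _ , ReachIn-source wu , vw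
  neighbour {Y} Y-conn 2≤∣Y∣ {v} v∈Y | no ∄u =
    contradiction (≤-trans 2≤∣Y∣ ∣Y∣≤1) λ { (s≤s ()) }
    where
      Y⊆⁅v⁆ : Y ⊆ ⁅ v ⁆
      Y⊆⁅v⁆ {u} u∈Y with u ≟ v
      ... | yes refl = x∈⁅x⁆ u
      ... | no u≢v   = contradiction (u , u∈Y , u≢v) ∄u
      ∣Y∣≤1 : ∣ Y ∣ ≤ 1
      ∣Y∣≤1 = subst (∣ Y ∣ ≤_) (∣⁅x⁆∣≡1 v) (p⊆q⇒∣p∣≤∣q∣ Y⊆⁅v⁆)

  edge-inside : ∀ {X : VSet G} → Connected G X → 2 ≤ ∣ X ∣ → ∃ λ e → lo e ∈ X × hi e ∈ X
  edge-inside {X} X-conn 2≤∣X∣ =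
    let v , v∈X      = 1≤∣X∣⇒Nonempty X (≤-trans (s≤s z≤n) 2≤∣X∣)
        w , w∈X , vw = neighbour X-conn 2≤∣X∣ v∈X
        e , ends     = toEdge vw
    in e , Ends⇒⊆ e ends v∈X w∈X

module Moves (G : Graph) (S S′ : VSet G) where
  open Edges G

  Passable : Vertex G → Set
  Passable v = ¬ (v ∈ S × v ∈ S′)

  SlideEdge : Edge G → Set
  SlideEdge h = ∃₂ λ x y → Slide G S S′ x y × Ends G h x y

  NonSlide : Edge G → Set
  NonSlide h = ¬ SlideEdge h

  Unguarded : VSet G → Set
  Unguarded Z = (∀ v → v ∈ Z → Passable v) × (∀ h → lo h ∈ Z → hi h ∈ Z → NonSlide h)

  slide-tail∉S′ : ∀ {x y} → Slide G S S′ x y → x ∉ S′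
  slide-tail∉S′ {x} {y} (xy , _ , _ , frame) x∈S′ with x ≟ y
  ... | yes x≡y = Adj⇒≢ xy x≡y
  ... | no x≢y  = proj₂ (proj₁ (frame x) (x∈S′ , x≢y)) refl

  slide-head∉S : ∀ {x y} → Slide G S S′ x y → y ∉ S
  slide-head∉S {x} {y} (xy , _ , _ , frame) y∈S with y ≟ x
  ... | yes y≡x = Adj⇒≢ xy (sym y≡x)
  ... | no y≢x  = proj₂ (proj₂ (frame y) (y∈S , y≢x)) refl

  slide-unique : ∀ {x y x′ y′} → Slide G S S′ x y → Slide G S S′ x′ y′ → x ≡ x′ × y ≡ y′
  slide-unique {x} {y} {x′} {y′} sl@(_ , x∈S , y∈S′ , _) (_ , _ , _ , frame′) =
    tails (x ≟ x′) , heads (y ≟ y′)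
    where
      tails : Dec (x ≡ x′) → x ≡ x′
      tails (yes x≡x′) = x≡x′
      tails (no x≢x′)  = contradiction (proj₁ (proj₂ (frame′ x) (x∈S , x≢x′))) (slide-tail∉S′ sl)
      heads : Dec (y ≡ y′) → y ≡ y′
      heads (yes y≡y′) = y≡y′
      heads (no y≢y′)  = contradiction (proj₁ (proj₁ (frame′ y) (y∈S′ , y≢y′))) (slide-head∉S sl)

  SlideEdge-unique : ∀ e f → SlideEdge e → SlideEdge f → e ≡ f
  SlideEdge-unique e f (_ , _ , sl , ends) (_ , _ , sl′ , ends′) with slide-unique sl sl′
  ... | refl , refl = Ends-injective e f ends ends′

  Disjoint-S⇒Unguarded : ∀ {Z} → Disjoint Z S → Unguarded Z
  Disjoint-S⇒Unguarded {Z} Z∩S = (λ v v∈Z (v∈S , _) → Z∩S v v∈Z v∈S) , nonSlide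
    where
      nonSlide : ∀ h → lo h ∈ Z → hi h ∈ Z → NonSlide h
      nonSlide h lo∈Z hi∈Z (x , _ , (_ , x∈S , _) , ends) with Ends⇒∈ᵉˡ h ends
      ... | inj₁ refl = Z∩S _ lo∈Z x∈S
      ... | inj₂ refl = Z∩S _ hi∈Z x∈S

  Disjoint-S′⇒Unguarded : ∀ {Z} → Disjoint Z S′ → Unguarded Z
  Disjoint-S′⇒Unguarded {Z} Z∩S′ = (λ v v∈Z (_ , v∈S′) → Z∩S′ v v∈Z v∈S′) , nonSlide
    where
      nonSlide : ∀ h → lo h ∈ Z → hi h ∈ Z → NonSlide h
      nonSlide h lo∈Z hi∈Z (_ , y , (_ , _ , y∈S′ , _) , ends) with Ends⇒∈ᵉʳ h ends
      ... | inj₁ refl = Z∩S′ _ lo∈Z y∈S′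
      ... | inj₂ refl = Z∩S′ _ hi∈Z y∈S′

  Slide? : ∀ x y → Dec (Slide G S S′ x y)
  Slide? x y = Adj? x y ×-dec (x ∈? S) ×-dec (y ∈? S′) ×-dec all? λ w →
    (((w ∈? S′) ×-dec ¬? (w ≟ y)) →-dec ((w ∈? S) ×-dec ¬? (w ≟ x))) ×-dec
    (((w ∈? S) ×-dec ¬? (w ≟ x)) →-dec ((w ∈? S′) ×-dec ¬? (w ≟ y)))

  SlideEdge? : ∀ h → Dec (SlideEdge h)
  SlideEdge? h = any? λ x → any? λ y → Slide? x y ×-dec Ends? h x y

  Step? : ∀ f g → Dec (Step G S S′ f g)
  Step? f g = ¬? (f ≟ᵉ g) ×-dec any? λ v →
    (v ∈ᵉ? f) ×-dec (v ∈ᵉ? g) ×-dec ¬? ((v ∈? S) ×-dec (v ∈? S′))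

  AddsOnly? : ∀ y → Dec (AddsOnly G S S′ y)
  AddsOnly? y = all? λ w →
    (((w ∈? S′) ×-dec ¬? (w ∈? S)) →-dec (w ≟ y)) ×-dec
    ((w ≟ y) →-dec ((w ∈? S′) ×-dec ¬? (w ∈? S)))

  InClear? : ∀ f → Dec (InClear G S S′ f)
  InClear? f = any? λ y → AddsOnly? y ×-dec any? λ x → (x ∈? S) ×-dec Ends? f x y

  -- An (S,S′)-avoiding pathway from e to e′ is a Step-chain whose edges after the first
  -- are Admissible: condition (ii) never restricts the first edge, and its clause for
  -- f₁ = f_t holds automatically because consecutive edges are distinct.
  Admissible : Edge G → Edge G → Pred (Edge G) 0ℓ
  Admissible e e′ h = SlideEdge h → h ≡ e ⊎ h ≡ e′

  StepInto : Pred (Edge G) 0ℓ → Rel (Edge G) 0ℓ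
  StepInto Q f g = Step G S S′ f g × Q g

  closed⇒mid-nonempty : ∀ {e e′} mid → Linked (Step G S S′) (e ∷ mid ++ [ e′ ]) → e ≡ e′ →
                        ∃ (_∈ˡ mid)
  closed⇒mid-nonempty []      ((e≢e′ , _) ∷ [-]) e≡e′ = contradiction e≡e′ e≢e′
  closed⇒mid-nonempty (c ∷ _) _                  _    = c , here refl

  Linked⇒Avoiding : ∀ {e e′} mid → Linked (StepInto (Admissible e e′)) (e ∷ mid ++ [ e′ ]) →
                    Avoiding G S S′ e mid e′
  Linked⇒Avoiding {e} {e′} mid l =
    steps , λ x y sl h ends h∈ → admissible h∈ (x , y , sl , ends) ,
                                 λ (h≡e , h≡e′) → closed⇒mid-nonempty mid steps (trans (sym h≡e) h≡e′)
    where
      steps : Linked (Step G S S′) (e ∷ mid ++ [ e′ ])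
      steps = Linked.map proj₁ l
      admissible : ∀ {h} → h ∈ˡ e ∷ mid ++ [ e′ ] → Admissible e e′ h
      admissible (here refl) _ = inj₁ refl
      admissible (there h∈)    = All.lookup (Linked-targets l) h∈

  Avoiding⇒Linked : ∀ {e e′} mid → Avoiding G S S′ e mid e′ →
                    Linked (StepInto (Admissible e e′)) (e ∷ mid ++ [ e′ ])
  Avoiding⇒Linked mid (steps , avoids) =
    Linked-restrict steps (All.tabulate λ h∈ (x , y , sl , ends) → proj₁ (avoids x y sl _ ends (there h∈)))

  InA? : ∀ e e′ → Dec (InA G S e S′ e′)
  InA? e e′ = ¬? ((lo e′ ∈? S′) ×-dec (hi e′ ∈? S′)) ×-dec
              map′ toPathway fromPathway (⁺? StepInto? edges ∈-edges e e′)
    where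
      open FloydWarshall (StepInto (Admissible e e′)) using (⁺?)
      StepInto? : B.Decidable (StepInto (Admissible e e′))
      StepInto? f g = Step? f g ×-dec (SlideEdge? g →-dec ((g ≟ᵉ e) ⊎-dec (g ≟ᵉ e′)))
      toPathway : TransClosure (StepInto (Admissible e e′)) e e′ → ∃ λ mid → Avoiding G S S′ e mid e′
      toPathway p = let mid , l = ⁺⇒Linked p in mid , Linked⇒Avoiding mid l
      fromPathway : (∃ λ mid → Avoiding G S S′ e mid e′) → TransClosure (StepInto (Admissible e e′)) e e′
      fromPathway (mid , avoiding) = Linked⇒⁺ mid (Avoiding⇒Linked mid avoiding)

  InFsp? : ∀ e e′ → Dec (InFsp G S e S′ e′)
  InFsp? e e′ = ((e′ ≟ᵉ e) ×-dec ¬? (InClear? e)) ⊎-dec InA? e e′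

  infix 4 _⇝_
  _⇝_ : Rel (Edge G) 0ℓ
  _⇝_ = Star (StepInto NonSlide)

  ⇝⇒InFsp : ∀ {e e′} → lo e ∉ S → hi e ∉ S → ¬ (lo e′ ∈ S′ × hi e′ ∈ S′) → e ⇝ e′ →
            InFsp G S e S′ e′
  ⇝⇒InFsp {e} lo∉S hi∉S _ ε =
    inj₁ (refl , λ (_ , _ , x , x∈S , ends) → uncleared x∈S (Ends⇒∈ᵉˡ e ends))
    where
      uncleared : ∀ {x} → x ∈ S → ¬ x ∈ᵉ e
      uncleared x∈S (inj₁ refl) = lo∉S x∈S
      uncleared x∈S (inj₂ refl) = hi∉S x∈S
  ⇝⇒InFsp {e} {e′} _ _ e′⊈S′ (r ◅ rs) =
    let mid , l = ⁺⇒Linked (◅⇒⁺ r rs)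
    in inj₂ (e′⊈S′ , mid , Linked⇒Avoiding mid (Linked.map admissible l))
    where
      admissible : ∀ {f g} → StepInto NonSlide f g → StepInto (Admissible e e′) f g
      admissible (step , nonSlide) = step , λ slide → contradiction slide nonSlide

  ⇝-turn : ∀ f g {v} → NonSlide g → v ∈ᵉ f → v ∈ᵉ g → Passable v → f ⇝ g
  ⇝-turn f g ns v∈f v∈g passable with f ≟ᵉ g
  ... | yes refl = ε
  ... | no f≢g   = ((f≢g , _ , v∈f , v∈g , passable) , ns) ◅ ε

  ⇝-within : ∀ {Z} → Unguarded Z → ∀ {u v} → ReachIn G Z u v →
             ∀ f → u ∈ᵉ f → ∃ λ g → v ∈ᵉ g × f ⇝ g
  ⇝-within _ (here _) f u∈f = f , u∈f , ε
  ⇝-within Z-ung@(passable , nonSlide) (there u∈Z uw wv) f u∈f =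
    let h , ends     = toEdge uw
        lo∈Z , hi∈Z  = Ends⇒⊆ h ends u∈Z (ReachIn-source wv)
        g , v∈g , h⇝g = ⇝-within Z-ung wv h (Ends⇒∈ᵉʳ h ends)
    in g , v∈g , ⇝-turn f h (nonSlide h lo∈Z hi∈Z) u∈f (Ends⇒∈ᵉˡ h ends) (passable _ u∈Z) ◅◅ h⇝g

  distinct⇒NonSlide : ∀ {e f} → e ≢ f → NonSlide e ⊎ NonSlide f
  distinct⇒NonSlide {e} {f} e≢f with SlideEdge? e
  ... | no ns    = inj₁ ns
  ... | yes sl-e = inj₂ λ sl-f → e≢f (SlideEdge-unique e f sl-e sl-f)

  escape : ∀ {X Y e} → Connected G X → Connected G Y → 2 ≤ ∣ Y ∣ → Touching G X Y →
           Disjoint X S → Disjoint Y S′ → lo e ∈ X → hi e ∈ X →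
           ∃ λ e′ → InFsp G S e S′ e′ × lo e′ ∈ Y × hi e′ ∈ Y
  escape {X} {Y} {e} X-conn Y-conn 2≤∣Y∣ touching X∩S Y∩S′ lo∈X hi∈X =
    let b , g , b∈Y , b∈g , e⇝g  = enter-Y touching
        e′ , lo∈Y , hi∈Y , g⇝e′ = leave-inside-Y b∈Y b∈g
        e′⊈S′ = λ (lo∈S′ , _) → Y∩S′ _ lo∈Y lo∈S′
    in e′ , ⇝⇒InFsp (X∩S _ lo∈X) (X∩S _ hi∈X) e′⊈S′ (e⇝g ◅◅ g⇝e′) , lo∈Y , hi∈Y
    where
      X-ung : Unguarded X
      X-ung = Disjoint-S⇒Unguarded X∩S
      Y-ung : Unguarded Y
      Y-ung = Disjoint-S′⇒Unguarded Y∩S′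

      walk-to : ∀ {a} → a ∈ X → ∃ λ g → a ∈ᵉ g × e ⇝ g
      walk-to a∈X = ⇝-within X-ung (X-conn _ _ lo∈X a∈X) e (inj₁ refl)

      cross : ∀ c {a b} → Ends G c a b → NonSlide c → a ∈ X → b ∈ Y →
              ∃₂ λ b g → b ∈ Y × b ∈ᵉ g × e ⇝ g
      cross c {a} {b} ends ns a∈X b∈Y =
        let g , a∈g , e⇝g = walk-to a∈X
            g⇝c = ⇝-turn g c ns a∈g (Ends⇒∈ᵉˡ c ends) (proj₁ X-ung a a∈X)
        in b , c , b∈Y , Ends⇒∈ᵉʳ c ends , e⇝g ◅◅ g⇝c

      enter-Y : Touching G X Y → ∃₂ λ b g → b ∈ Y × b ∈ᵉ g × e ⇝ g
      enter-Y (inj₁ (v , v∈X , v∈Y)) = let g , v∈g , e⇝g = walk-to v∈X in v , g , v∈Y , v∈g , e⇝g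
      enter-Y (inj₂ (e₁ , e₂ , e₁≢e₂ , _ , _ , _ , _ , ends₁ , ends₂ , x₁∈X , y₁∈X , x₂∈Y , y₂∈Y))
        with distinct⇒NonSlide e₁≢e₂
      ... | inj₁ ns₁ = cross e₁ ends₁ ns₁ x₁∈X x₂∈Y
      ... | inj₂ ns₂ = cross e₂ ends₂ ns₂ y₁∈X y₂∈Y

      leave-inside-Y : ∀ {b g} → b ∈ Y → b ∈ᵉ g → ∃ λ e′ → lo e′ ∈ Y × hi e′ ∈ Y × g ⇝ e′
      leave-inside-Y {b} {g} b∈Y b∈g =
        let w , w∈Y , bw = neighbour Y-conn 2≤∣Y∣ b∈Y
            e′ , ends    = toEdge bw
            lo∈Y , hi∈Y  = Ends⇒⊆ e′ ends b∈Y w∈Y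
            g⇝e′ = ⇝-turn g e′ (proj₂ Y-ung e′ lo∈Y hi∈Y) b∈g (Ends⇒∈ᵉˡ e′ ends) (proj₁ Y-ung b b∈Y)
        in e′ , lo∈Y , hi∈Y , g⇝e′

module Hiding (G : Graph) (B : List (VSet G)) (tb : TightBramble G B) where
  open Edges G

  Hideout : VSet G → Edge G → Set
  Hideout T e = ∃ λ Y → Y ∈ˡ B × Disjoint Y T × lo e ∈ Y × hi e ∈ Y

  Hideout? : ∀ T e → Dec (Hideout T e)
  Hideout? T e = ∃∈? (λ Y → Disjoint? Y T ×-dec (lo e ∈? Y) ×-dec (hi e ∈? Y)) B

  initial-hideout : ∀ {X} → X ∈ˡ B → ∃ (Hideout ⊥)
  initial-hideout {X} X∈B =
    let X-conn , 2≤∣X∣    = proj₁ tb X X∈B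
        e , lo∈X , hi∈X = edge-inside X-conn 2≤∣X∣
    in e , X , X∈B , Disjoint-⊥ X , lo∈X , hi∈X

  hideout-escape : ∀ {S e S′} → Hideout S e → ∀ {Y} → Y ∈ˡ B → Disjoint Y S′ →
                   ∃ λ e′ → InFsp G S e S′ e′ × Hideout S′ e′
  hideout-escape {S} {e} {S′} (X , X∈B , X∩S , lo∈X , hi∈X) {Y} Y∈B Y∩S′ =
    let X-conn , _        = proj₁ tb X X∈B
        Y-conn , 2≤∣Y∣    = proj₁ tb Y Y∈B
        e′ , fsp , lo∈Y , hi∈Y =
          Moves.escape G S S′ X-conn Y-conn 2≤∣Y∣ (proj₂ tb X Y X∈B Y∈B) X∩S Y∩S′ lo∈X hi∈X
    in e′ , fsp , Y , Y∈B , Y∩S′ , lo∈Y , hi∈Y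

  cover-or-avoided : ∀ C → IsCover G B C ⊎ ∃ λ Y → Y ∈ˡ B × Disjoint Y C
  cover-or-avoided C with ∃∈? (λ Y → Disjoint? Y C) B
  ... | yes avoided = inj₂ avoided
  ... | no ∄avoided = inj₁ meets
    where
      meets : IsCover G B C
      meets X X∈B with any? (λ v → (v ∈? C) ×-dec (v ∈? X))
      ... | yes v∈C∩X = v∈C∩X
      ... | no ∄v     = contradiction (X , X∈B , λ v v∈X v∈C → ∄v (v , v∈C , v∈X)) ∄avoided

  data Choice (S : VSet G) (e : Edge G) (S′ : VSet G) : Set where
    hide    : ∀ e′ → InFsp G S e S′ e′ → Hideout S′ e′ → Choice S e S′
    exposed : ∀ e′ → InFsp G S e S′ e′ → (∀ e″ → InFsp G S e S′ e″ → ¬ Hideout S′ e″) →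
              Choice S e S′
    caught  : (∀ e′ → ¬ InFsp G S e S′ e′) → Choice S e S′

  -- Abstract, so that goals mentioning the fugitive never unfold the decision procedures.
  abstract
    choose : ∀ S e S′ → Choice S e S′
    choose S e S′ with ∃ᵉ? (λ e′ → Moves.InFsp? G S S′ e e′ ×-dec Hideout? S′ e′)
                     | ∃ᵉ? (Moves.InFsp? G S S′ e)
    ... | yes (e′ , fsp , hid) | _             = hide e′ fsp hid
    ... | no ∄hid              | yes (e′ , fsp) =
      exposed e′ fsp λ e″ fsp″ hid″ → ∄hid (e″ , fsp″ , hid″)
    ... | no _                 | no ∄fsp        = caught λ e′ fsp → ∄fsp (e′ , fsp)

  fugitive : VSet G → Edge G → VSet G → Maybe (Edge G)
  fugitive S e S′ with choose S e S′
  ... | hide e′ _ _    = just e′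
  ... | exposed e′ _ _ = just e′
  ... | caught _       = nothing

  fugitive-valid : ValidFugitiveFn G fugitive
  fugitive-valid S e S′ with choose S e S′
  ... | hide _ fsp _    = fsp
  ... | exposed _ fsp _ = fsp
  ... | caught ∄fsp     = ∄fsp

  fugitive-hides : ∀ {S e S′} → Hideout S e → ∀ {Y} → Y ∈ˡ B → Disjoint Y S′ →
                   ∃ λ e′ → fugitive S e S′ ≡ just e′ × Hideout S′ e′
  fugitive-hides {S} {e} {S′} hid Y∈B Y∩S′ with choose S e S′ | hideout-escape hid Y∈B Y∩S′
  ... | hide e′ _ hid′   | _                  = e′ , refl , hid′
  ... | exposed _ _ ∄hid | e″ , fsp″ , hid″   = contradiction hid″ (∄hid e″ fsp″)
  ... | caught ∄fsp      | e″ , fsp″ , _      = contradiction fsp″ (∄fsp e″)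

module Pursuit (G : Graph) (B : List (VSet G)) (tb : TightBramble G B) {k : ℕ}
               (k≤cover : ∀ C → IsCover G B C → k ≤ ∣ C ∣) (s : SearchStrategy G) (e₁ : Edge G) where
  open Hiding G B tb

  φ : FugitiveStrategy G
  φ = e₁ , fugitive , fugitive-valid

  play-step : ∀ i {S e} → play G s φ i ≡ (S , just e) →
              play G s φ (suc i) ≡ (proj₁ s S e , fugitive S e (proj₁ s S e))
  play-step i eq rewrite eq = refl

  Expensive : Set
  Expensive = ∃ λ j → k ≤ ∣ proj₁ (play G s φ j) ∣

  Hidden : ℕ → Set
  Hidden i = ∃₂ λ S e → play G s φ i ≡ (S , just e) × Hideout S e

  hidden-until-expensive : Hideout ⊥ e₁ → ∀ i → Expensive ⊎ Hidden i
  hidden-until-expensive hid₁ zero = inj₂ (⊥ , e₁ , refl , hid₁)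
  hidden-until-expensive hid₁ (suc i) with hidden-until-expensive hid₁ i
  ... | inj₁ expensive           = inj₁ expensive
  ... | inj₂ (S , e , eq , hid) with cover-or-avoided (proj₁ s S e)
  ...   | inj₁ cover =
    inj₁ (suc i , subst (λ p → k ≤ ∣ proj₁ p ∣) (sym (play-step i eq)) (k≤cover _ cover))
  ...   | inj₂ (Y , Y∈B , Y∩S′) =
    let e′ , chosen , hid′ = fugitive-hides hid Y∈B Y∩S′
    in inj₂ (_ , e′ , trans (play-step i eq) (cong (_ ,_) chosen) , hid′)

  cost : Hideout ⊥ e₁ → Winning G s → CostAtLeast G s k
  cost hid₁ winning with winning φ
  ... | i , ended with hidden-until-expensive hid₁ i
  ...   | inj₁ (j , k≤∣Sⱼ∣)     = φ , j , k≤∣Sⱼ∣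
  ...   | inj₂ (_ , _ , eq , _) = contradiction (trans (sym (cong proj₂ eq)) ended) λ ()

lemma15 : (G : Graph) (k : ℕ) → 1 ≤ k → (B : List (VSet G)) →
          TightBramble G B → HasOrder G B k → AvmsAtLeast G k
lemma15 G k 1≤k [] _ (_ , k≤cover) _ _ =
  contradiction (≤-trans 1≤k (subst (k ≤_) (∣⊥∣≡0 (Graph.n G)) (k≤cover ⊥ λ _ ()))) λ ()
lemma15 G k _ B@(_ ∷ _) tb (_ , k≤cover) s winning =
  let e₁ , hid₁ = Hiding.initial-hideout G B tb (here refl)
  in Pursuit.cost G B tb k≤cover s e₁ hid₁ winning
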